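{- Let $1\le k<n$ and fix $a\in[k]$. For $b\in\{0,\dots,n-k\}$ let $V^{a,b}_{k,n}=\{I\in V_{k,n}: i_a=a+b\}$ and $\mathcal{O}^{a,b}_{k,n}=\mathrm{conv}\{\chi_I: I\in V^{a,b}_{k,n}\}$. Then $\mathcal{O}_{k,n}$ is the Cayley sum $\mathcal{C}(\mathcal{O}^{a,0}_{k,n},\dots,\mathcal{O}^{a,n-k}_{k,n})$; explicitly, splitting $\mathbb{R}^{[k]\times[n-k]}=\mathbb{R}^{\{a\}\times[n-k]}\times\mathbb{R}^{([k]\setminus\{a\})\times[n-k]}$, one has $\mathcal{O}^{a,b}_{k,n}=\{v_b\}\times Q_b$ where $v_b=(0,\dots,0,1,\dots,1)$ ($b$ zeros followed by $n-k-b$ ones) and $Q_b$ is the projection of $\mathcal{O}^{a,b}_{k,n}$ to the second factor, the points $v_0,\dots,v_{n-k}$ are the vertices of a unimodular simplex, and $\mathcal{O}_{k,n}=\mathrm{conv}\bigcup_{b=0}^{n-k}(\{v_b\}\times Q_b)$.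
   Context: $V_{k,n}$ is the set of strictly increasing vectors $(i_1,\dots,i_k)$ with entries in $[n]$. For $I\in V_{k,n}$, $\chi_I\in\{0,1\}^{[k]\times[n-k]}$ has $(\chi_I)_{a,b}=1$ iff $i_a\le a+b-1$, and $\mathcal{O}_{k,n}=\mathrm{conv}\{\chi_I: I\in V_{k,n}\}$. Given a unimodular simplex with vertices $v_1,\dots,v_\ell$ and lattice polytopes $Q_1,\dots,Q_\ell\subset\mathbb{R}^m$, their Cayley sum is $\mathcal{C}(Q_1,\dots,Q_\ell)=\mathrm{conv}\bigcup_i(Q_i\times\{v_i\})$.
   Formalization: The polytopes $\mathcal{O}_{k,n}$, $\mathcal{O}^{a,b}_{k,n}$, $Q_b$ and the Cayley sum consist of rational points rather than real ones, with convex hulls taken with rational weights. -}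

module Defs where

open import Data.Nat as ℕ using (ℕ; suc; _<_; _≤_; _≤?_; _∸_; _+_)
open import Data.Fin as Fin using (Fin; toℕ)
open import Data.Integer as ℤ using (ℤ; +_)
open import Data.Rational as ℚ using (ℚ; 0ℚ; 1ℚ)
open import Data.List using (List; foldr; map)
open import Data.List.Relation.Unary.All using (All)
open import Data.Product using (Σ; ∃; _×_; _,_; proj₁; proj₂)
open import Data.Sum using (_⊎_; inj₁; inj₂)
open import Relation.Binary.PropositionalEquality using (_≡_; _≢_)
open import Relation.Nullary.Decidable using (does)
open import Data.Bool using (if_then_else_)

Pt : Set → Set
Pt X = X → ℚ

sumℚ : List ℚ → ℚ
sumℚ = foldr ℚ._+_ 0ℚ

conv : {X : Set} → (Pt X → Set) → Pt X → Set
conv {X} S x =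
  Σ (List (ℚ × Pt X)) λ L →
    All (λ wp → (0ℚ ℚ.≤ proj₁ wp) × S (proj₂ wp)) L
    × sumℚ (map proj₁ L) ≡ 1ℚ
    × (∀ j → x j ≡ sumℚ (map (λ wp → proj₁ wp ℚ.* proj₂ wp j) L))

-- V_{k,n}: strictly increasing vectors (i_1,…,i_k) with entries in [n] = {1,…,n}.
-- Position r : Fin k stands for index toℕ r + 1.
V : (k n : ℕ) → (Fin k → ℕ) → Set
V k n I = (∀ r → 1 ≤ I r × I r ≤ n) × (∀ r s → r Fin.< s → I r < I s)

-- χ_I ∈ {0,1}^{[k]×[n-k]}, (χ_I)_{a,b} = 1 iff i_a ≤ a+b-1 (1-indexed a,b).
χ : (k n : ℕ) → (Fin k → ℕ) → Pt (Fin k × Fin (n ∸ k))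
χ k n I (r , c) = if does (I r ≤? (suc (toℕ r) + suc (toℕ c)) ∸ 1) then 1ℚ else 0ℚ

isχ : (k n : ℕ) → Pt (Fin k × Fin (n ∸ k)) → Set
isχ k n x = ∃ λ I → V k n I × (∀ j → x j ≡ χ k n I j)

O : (k n : ℕ) → Pt (Fin k × Fin (n ∸ k)) → Set
O k n = conv (isχ k n)

isχab : (k n : ℕ) → Fin k → Fin (suc (n ∸ k)) → Pt (Fin k × Fin (n ∸ k)) → Set
isχab k n a b x =
  ∃ λ I → V k n I × I a ≡ suc (toℕ a) + toℕ b × (∀ j → x j ≡ χ k n I j)

Oab : (k n : ℕ) → Fin k → Fin (suc (n ∸ k)) → Pt (Fin k × Fin (n ∸ k)) → Set
Oab k n a b = conv (isχab k n a b)

Other : {k : ℕ} → Fin k → ℕ → Set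
Other {k} a m = Σ (Fin k) (λ r → r ≢ a) × Fin m

split : {k m : ℕ} (a : Fin k) → Pt (Fin k × Fin m) → Pt (Fin m ⊎ Other a m)
split a x (inj₁ c) = x (a , c)
split a x (inj₂ ((r , _) , c)) = x (r , c)

Qb : (k n : ℕ) (a : Fin k) → Fin (suc (n ∸ k)) → Pt (Other a (n ∸ k)) → Set
Qb k n a b y = ∃ λ x → Oab k n a b x × (∀ j → split a x (inj₂ j) ≡ y j)

vZ : (m : ℕ) → Fin (suc m) → Fin m → ℤ
vZ m b c = if does (suc (toℕ c) ≤? toℕ b) then + 0 else + 1

vQ : (m : ℕ) → Fin (suc m) → Pt (Fin m)
vQ m b c = ℚ._/_ (vZ m b c) 1

-- Unimodular simplex with vertices v_0,…,v_d in ℤ^d (full-dimensional):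
-- the edge vectors v_{i+1} - v_0 form a ℤ-basis of ℤ^d.
sumℤ : {d : ℕ} → (Fin d → ℤ) → ℤ
sumℤ {ℕ.zero} f = + 0
sumℤ {suc d} f = f Fin.zero ℤ.+ sumℤ (λ i → f (Fin.suc i))

IsZCombo : {d : ℕ} → (Fin (suc d) → Fin d → ℤ) → (Fin d → ℤ) → (Fin d → ℤ) → Set
IsZCombo {d} v c z =
  ∀ j → z j ≡ sumℤ (λ i → c i ℤ.* (v (Fin.suc i) j ℤ.- v Fin.zero j))

UnimodularSimplex : (d : ℕ) → (Fin (suc d) → Fin d → ℤ) → Set
UnimodularSimplex d v =
  (∀ z → ∃ λ c → IsZCombo v c z)
  × (∀ z c c' → IsZCombo v c z → IsZCombo v c' z → ∀ i → c i ≡ c' i)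

-- Cayley sum C(Q_0,…,Q_ℓ) = conv ⋃_i ({v_i} × Q_i) (simplex factor listed first).
Cayley : {A B : Set} {ℓ : ℕ} → (Fin ℓ → Pt A) → (Fin ℓ → Pt B → Set) → Pt (A ⊎ B) → Set
Cayley vs Qs = conv (λ p → ∃ λ i → (∀ j → p (inj₁ j) ≡ vs i j) × Qs i (λ j → p (inj₂ j)))

module Submission where

-- Fix a row a and split coordinates as (row a | other rows).
--  (1) If I ∈ V_{k,n} has i_a = a+b then row a of χ_I is exactly v_b
--      (χ-row); since a coordinate that is constant on a generating set is
--      constant on its convex hull, every point of O^{a,b} has row a equal
--      to v_b.  Hence O^{a,b} = {v_b} × Q_b, because a point is determined
--      by its two blocks of coordinates (split-determines).
--  (2) The edges v_{i+1} - v_0 form a triangular matrix with diagonal -1,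
--      so the edge map is a bijection of ℤ^{n-k}; its inverse is written
--      down explicitly (edgeCoefficients), giving unimodularity.
--  (3) Every I ∈ V_{k,n} satisfies a ≤ i_a ≤ a+(n-k) (rowIndex), so each
--      vertex χ_I lies in some slice {v_b} × Q_b; conversely each slice lies
--      in O_{k,n}.  The Cayley identity follows from two facts about convex
--      hulls: they can be pulled back along coordinate maps (conv-pullback)
--      and conv (conv S) = conv S (conv-flatten).
-- In the code rows are 0-based, so the paper's i_a = a+b reads I a = (a+1)+b.

open import Defs
open import Data.Nat using (ℕ; suc; _≤_; _<_; _∸_)
open import Data.Fin using (Fin)
open import Data.Product using (_×_)
open import Data.Sum using (inj₁; inj₂)
open import Function.Bundles using (_⇔_)
open import Relation.Binary.PropositionalEquality using (_≡_)

open import Data.Nat as ℕ using (zero; _+_; _≤?_; z≤n; s≤s; s≤s⁻¹)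
import Data.Nat.Properties as ℕP
open import Data.Fin as Fin using (toℕ; fromℕ; fromℕ<; _≟_) renaming (zero to fz; suc to fs)
import Data.Fin.Properties as FinP
open import Data.Integer as ℤ using (ℤ)
open import Data.Integer.Tactic.RingSolver using (solve-∀)
open import Data.Rational as ℚ using (ℚ; 0ℚ; 1ℚ)
import Data.Rational.Properties as ℚP
import Data.Integer.Properties as ℤP
open import Data.List using (List; []; _∷_; map; _++_)
import Data.List.Properties as ListP
open import Data.List.Relation.Unary.All as All using (All; []; _∷_)
import Data.List.Relation.Unary.All.Properties as AllP
open import Data.Product using (Σ; _,_; proj₁; proj₂)
open import Data.Sum using (_⊎_)
open import Data.Bool using (if_then_else_)
open import Function using (_∘_; mk⇔)
open import Relation.Binary.PropositionalEquality using (refl; sym; trans; cong; cong₂; subst; module ≡-Reasoning)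
open import Relation.Nullary using (yes; no; does)
open import Relation.Nullary.Decidable using (dec-true; dec-false; does-⇔)

-- Convex hulls of sets of rational points

Combination : Set → Set
Combination X = List (ℚ × Pt X)

totalWeight : {X : Set} → Combination X → ℚ
totalWeight L = sumℚ (map proj₁ L)

combine : {X : Set} → Combination X → Pt X
combine L j = sumℚ (map (λ wp → proj₁ wp ℚ.* proj₂ wp j) L)

SupportedOn : {X : Set} → (Pt X → Set) → Combination X → Set
SupportedOn S = All (λ wp → (0ℚ ℚ.≤ proj₁ wp) × S (proj₂ wp))

conv-resp : {X : Set} {S : Pt X → Set} {x y : Pt X} →
  (∀ j → y j ≡ x j) → conv S x → conv S y
conv-resp y≈x (L , supp , total , x≡) = L , supp , total , λ j → trans (y≈x j) (x≡ j)

conv-mono : {X : Set} {S T : Pt X → Set} → (∀ p → S p → T p) → ∀ x → conv S x → conv T x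
conv-mono S⊆T x (L , supp , total , x≡) = L , All.map (λ (w≥0 , s) → w≥0 , S⊆T _ s) supp , total , x≡

conv-singleton : {X : Set} {S : Pt X → Set} {p : Pt X} → S p → conv S p
conv-singleton {p = p} s =
  ((1ℚ , p) ∷ []) , ((ℚP.nonNegative⁻¹ 1ℚ , s) ∷ []) , ℚP.+-identityʳ 1ℚ ,
  λ j → sym (trans (ℚP.+-identityʳ _) (ℚP.*-identityˡ _))

combine-constant : {X : Set} (L : Combination X) (j : X) (v : ℚ) →
  All (λ wp → proj₂ wp j ≡ v) L → combine L j ≡ totalWeight L ℚ.* v
combine-constant [] j v [] = sym (ℚP.*-zeroˡ v)
combine-constant ((w , p) ∷ L) j v (pj≡v ∷ rest) =
  trans (cong₂ ℚ._+_ (cong (w ℚ.*_) pj≡v) (combine-constant L j v rest))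
        (sym (ℚP.*-distribʳ-+ v w (totalWeight L)))

conv-constant : {X : Set} {S : Pt X → Set} (j : X) (v : ℚ) →
  (∀ p → S p → p j ≡ v) → ∀ x → conv S x → x j ≡ v
conv-constant j v const x (L , supp , total , x≡) = begin
  x j                      ≡⟨ x≡ j ⟩
  combine L j              ≡⟨ combine-constant L j v (All.map (λ (_ , s) → const _ s) supp) ⟩
  totalWeight L ℚ.* v      ≡⟨ cong (ℚ._* v) total ⟩
  1ℚ ℚ.* v                 ≡⟨ ℚP.*-identityˡ v ⟩
  v                        ∎
  where open ≡-Reasoning

conv-pullback : {X Y : Set} {S : Pt X → Set} {T : Pt Y → Set} (σ : Y → X) →
  (∀ p → S p → T (p ∘ σ)) → ∀ x → conv S x → conv T (x ∘ σ)
conv-pullback σ S⇒T x (L , supp , total , x≡) =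
  pulled , AllP.map⁺ (All.map (λ (w≥0 , s) → w≥0 , S⇒T _ s) supp) ,
  trans (cong sumℚ (sym (ListP.map-∘ L))) total ,
  λ j → trans (x≡ (σ j)) (cong sumℚ (ListP.map-∘ L))
  where pulled = map (λ wp → proj₁ wp , proj₂ wp ∘ σ) L

scale : {X : Set} → ℚ → Combination X → Combination X
scale w [] = []
scale w ((u , p) ∷ M) = (w ℚ.* u , p) ∷ scale w M

totalWeight-scale : {X : Set} (w : ℚ) (M : Combination X) →
  totalWeight (scale w M) ≡ w ℚ.* totalWeight M
totalWeight-scale w [] = sym (ℚP.*-zeroʳ w)
totalWeight-scale w ((u , p) ∷ M) =
  trans (cong (w ℚ.* u ℚ.+_) (totalWeight-scale w M)) (sym (ℚP.*-distribˡ-+ w u (totalWeight M)))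

combine-scale : {X : Set} (w : ℚ) (M : Combination X) (j : X) →
  combine (scale w M) j ≡ w ℚ.* combine M j
combine-scale w [] j = sym (ℚP.*-zeroʳ w)
combine-scale w ((u , p) ∷ M) j =
  trans (cong₂ ℚ._+_ (ℚP.*-assoc w u (p j)) (combine-scale w M j))
        (sym (ℚP.*-distribˡ-+ w (u ℚ.* p j) (combine M j)))

supported-scale : {X : Set} {S : Pt X → Set} {w : ℚ} → 0ℚ ℚ.≤ w →
  (M : Combination X) → SupportedOn S M → SupportedOn S (scale w M)
supported-scale w≥0 [] [] = []
supported-scale {w = w} w≥0 ((u , p) ∷ M) ((u≥0 , s) ∷ rest) =
  (ℚP.nonNegative⁻¹ _ {{ℚP.nonNeg*nonNeg⇒nonNeg w {{ℚ.nonNegative w≥0}} u {{ℚ.nonNegative u≥0}}}} , s)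
  ∷ supported-scale w≥0 M rest

totalWeight-++ : {X : Set} (A B : Combination X) → totalWeight (A ++ B) ≡ totalWeight A ℚ.+ totalWeight B
totalWeight-++ [] B = sym (ℚP.+-identityˡ _)
totalWeight-++ ((w , p) ∷ A) B = trans (cong (w ℚ.+_) (totalWeight-++ A B)) (sym (ℚP.+-assoc w _ _))

combine-++ : {X : Set} (A B : Combination X) (j : X) → combine (A ++ B) j ≡ combine A j ℚ.+ combine B j
combine-++ [] B j = sym (ℚP.+-identityˡ _)
combine-++ ((w , p) ∷ A) B j =
  trans (cong (w ℚ.* p j ℚ.+_) (combine-++ A B j)) (sym (ℚP.+-assoc (w ℚ.* p j) _ _))

-- A nonnegative combination of points of conv S is a nonnegative combination
-- of points of S with the same total weight and the same combined point:
-- substitute w·M for each weighted point (w , combine M).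
flatten : {X : Set} {S : Pt X → Set} (L : Combination X) → SupportedOn (conv S) L →
  Σ (Combination X) λ L' → SupportedOn S L' × totalWeight L' ≡ totalWeight L × (∀ j → combine L' j ≡ combine L j)
flatten [] [] = [] , [] , refl , λ j → refl
flatten ((w , p) ∷ L) ((w≥0 , (M , suppM , totalM , p≡)) ∷ rest) with flatten L rest
... | L' , supp' , total' , combine' =
  scale w M ++ L' , AllP.++⁺ (supported-scale w≥0 M suppM) supp' ,
  trans (totalWeight-++ (scale w M) L')
        (cong₂ ℚ._+_ (trans (totalWeight-scale w M) (trans (cong (w ℚ.*_) totalM) (ℚP.*-identityʳ w))) total') ,
  λ j → trans (combine-++ (scale w M) L' j)
              (cong₂ ℚ._+_ (trans (combine-scale w M j) (cong (w ℚ.*_) (sym (p≡ j)))) (combine' j))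

conv-flatten : {X : Set} {S : Pt X → Set} → ∀ x → conv (conv S) x → conv S x
conv-flatten x (L , supp , total , x≡) with flatten L supp
... | L' , supp' , total' , combine' = L' , supp' , trans total' total , λ j → trans (x≡ j) (sym (combine' j))

module _ {k m : ℕ} (a : Fin k) where

  splitIndex : Fin m ⊎ Other a m → Fin k × Fin m
  splitIndex (inj₁ c) = a , c
  splitIndex (inj₂ ((r , _) , c)) = r , c

  mergeIndex : Fin k × Fin m → Fin m ⊎ Other a m
  mergeIndex (r , c) with r ≟ a
  ... | yes _ = inj₁ c
  ... | no r≢a = inj₂ ((r , r≢a) , c)

  split-pullback : (x : Pt (Fin k × Fin m)) → ∀ j → split a x j ≡ x (splitIndex j)
  split-pullback x (inj₁ c) = refl
  split-pullback x (inj₂ j) = refl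

  split-merge : (x : Pt (Fin k × Fin m)) → ∀ j → split a x (mergeIndex j) ≡ x j
  split-merge x (r , c) with r ≟ a
  ... | yes refl = refl
  ... | no _ = refl

  split-determines : (x : Pt (Fin k × Fin m)) (p : Pt (Fin m ⊎ Other a m)) →
    (∀ j → split a x j ≡ p j) → ∀ j → x j ≡ p (mergeIndex j)
  split-determines x p split≡ j = trans (sym (split-merge x j)) (split≡ (mergeIndex j))

StrictlyIncreasing : {k : ℕ} → (Fin k → ℕ) → Set
StrictlyIncreasing f = ∀ r s → r Fin.< s → f r < f s

increasing-tail : {k : ℕ} (f : Fin (suc k) → ℕ) → StrictlyIncreasing f → StrictlyIncreasing (f ∘ fs)
increasing-tail f inc r s r<s = inc (fs r) (fs s) (s≤s r<s)

increasing-gap : {k : ℕ} (f : Fin k → ℕ) → StrictlyIncreasing f →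
  ∀ r s → toℕ r ≤ toℕ s → f r + (toℕ s ∸ toℕ r) ≤ f s
increasing-gap f inc fz fz _ = ℕP.≤-reflexive (ℕP.+-identityʳ (f fz))
increasing-gap {suc (suc _)} f inc fz (fs s) _ = begin
  f fz + suc (toℕ s)   ≡⟨ ℕP.+-suc (f fz) (toℕ s) ⟩
  suc (f fz) + toℕ s   ≤⟨ ℕP.+-monoˡ-≤ (toℕ s) (inc fz (fs fz) (s≤s z≤n)) ⟩
  f (fs fz) + toℕ s    ≤⟨ increasing-gap (f ∘ fs) (increasing-tail f inc) fz s z≤n ⟩
  f (fs s)             ∎
  where open ℕP.≤-Reasoning
increasing-gap f inc (fs r) (fs s) r≤s =
  increasing-gap (f ∘ fs) (increasing-tail f inc) r s (s≤s⁻¹ r≤s)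

-- For I ∈ V_{k,n} and a 0-based row a: a+1 ≤ I a and I a + (k-(a+1)) ≤ n,
-- since I a has a smaller entries before it and k-(a+1) larger ones after it.
entry-bounds : {k n : ℕ} (I : Fin k → ℕ) → V k n I → (a : Fin k) →
  suc (toℕ a) ≤ I a × I a + (k ∸ suc (toℕ a)) ≤ n
entry-bounds {suc k'} {n} I (inRange , inc) a = lower , upper
  where
  lower : suc (toℕ a) ≤ I a
  lower = ℕP.≤-trans (ℕP.+-monoˡ-≤ (toℕ a) (proj₁ (inRange fz))) (increasing-gap I inc fz a z≤n)
  last≤n : I (fromℕ k') ≤ n
  last≤n = proj₂ (inRange (fromℕ k'))
  gap : I a + (toℕ (fromℕ k') ∸ toℕ a) ≤ I (fromℕ k')
  gap = increasing-gap I inc a (fromℕ k') (FinP.≤fromℕ a)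
  upper : I a + (k' ∸ toℕ a) ≤ n
  upper = subst (λ t → I a + (t ∸ toℕ a) ≤ n) (FinP.toℕ-fromℕ k') (ℕP.≤-trans gap last≤n)

rowIndex : {k n : ℕ} (I : Fin k → ℕ) → V k n I → (a : Fin k) →
  Σ (Fin (suc (n ∸ k))) λ b → I a ≡ suc (toℕ a) + toℕ b
rowIndex {k} {n} I VI a = fromℕ< (s≤s b≤n∸k) , I≡
  where
  lower = proj₁ (entry-bounds I VI a)
  upper = proj₂ (entry-bounds I VI a)
  b = I a ∸ suc (toℕ a)
  d = k ∸ suc (toℕ a)
  b+k≡ : b + k ≡ I a + d
  b+k≡ = begin
    b + k                      ≡⟨ cong (b +_) (sym (ℕP.m+[n∸m]≡n (FinP.toℕ<n a))) ⟩
    b + (suc (toℕ a) + d)      ≡⟨ sym (ℕP.+-assoc b (suc (toℕ a)) d) ⟩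
    (b + suc (toℕ a)) + d      ≡⟨ cong (_+ d) (ℕP.m∸n+n≡m lower) ⟩
    I a + d                    ∎
    where open ≡-Reasoning
  b≤n∸k : b ≤ n ∸ k
  b≤n∸k = ℕP.m+n≤o⇒m≤o∸n b (ℕP.≤-trans (ℕP.≤-reflexive b+k≡) upper)
  I≡ : I a ≡ suc (toℕ a) + toℕ (fromℕ< (s≤s b≤n∸k))
  I≡ = trans (sym (ℕP.m+[n∸m]≡n lower)) (cong (suc (toℕ a) +_) (sym (FinP.toℕ-fromℕ< (s≤s b≤n∸k))))

-- Both χ_I and v_b are 0/1 step functions; compare them through the
-- indicator of b ≤ c.
step : ℕ → ℕ → ℚ
step b c = if does (b ≤? c) then 1ℚ else 0ℚ

vQ-step : (m : ℕ) (b : Fin (suc m)) (c : Fin m) → vQ m b c ≡ step (toℕ b) (toℕ c)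
vQ-step m b c with toℕ b ≤? toℕ c
... | yes b≤c rewrite dec-true (toℕ b ≤? toℕ c) b≤c | dec-false (suc (toℕ c) ≤? toℕ b) (ℕP.≤⇒≯ b≤c) = refl
... | no b≰c rewrite dec-false (toℕ b ≤? toℕ c) b≰c | dec-true (suc (toℕ c) ≤? toℕ b) (ℕP.≰⇒> b≰c) = refl

χ-step : (k n : ℕ) (I : Fin k → ℕ) (a : Fin k) (b : ℕ) (c : Fin (n ∸ k)) →
  I a ≡ suc (toℕ a) + b → χ k n I (a , c) ≡ step b (toℕ c)
χ-step k n I a b c Ia≡ =
  cong (if_then 1ℚ else 0ℚ) (does-⇔ (mk⇔ to from) (I a ≤? toℕ a + suc (toℕ c)) (b ≤? toℕ c))
  where
  shift : ∀ x → toℕ a + suc x ≡ suc (toℕ a) + x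
  shift x = ℕP.+-suc (toℕ a) x
  to : I a ≤ toℕ a + suc (toℕ c) → b ≤ toℕ c
  to le rewrite Ia≡ | shift (toℕ c) = ℕP.+-cancelˡ-≤ (suc (toℕ a)) b (toℕ c) le
  from : b ≤ toℕ c → I a ≤ toℕ a + suc (toℕ c)
  from le rewrite Ia≡ | shift (toℕ c) = ℕP.+-monoʳ-≤ (suc (toℕ a)) le

χ-row : (k n : ℕ) (I : Fin k → ℕ) (a : Fin k) (b : Fin (suc (n ∸ k))) (c : Fin (n ∸ k)) →
  I a ≡ suc (toℕ a) + toℕ b → χ k n I (a , c) ≡ vQ (n ∸ k) b c
χ-row k n I a b c Ia≡ = trans (χ-step k n I a (toℕ b) c Ia≡) (sym (vQ-step (n ∸ k) b c))

-- Part (1): O^{a,b} = {v_b} × Q_b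

module _ (k n : ℕ) (a : Fin k) where

  Oab-row : (b : Fin (suc (n ∸ k))) (x : Pt (Fin k × Fin (n ∸ k))) →
    Oab k n a b x → ∀ c → x (a , c) ≡ vQ (n ∸ k) b c
  Oab-row b x o c = conv-constant (a , c) (vQ (n ∸ k) b c)
    (λ p (I , _ , Ia≡ , p≡χ) → trans (p≡χ (a , c)) (χ-row k n I a b c Ia≡)) x o

  Oab-merge : (b : Fin (suc (n ∸ k))) (x : Pt (Fin k × Fin (n ∸ k)))
    (p : Pt (Fin (n ∸ k) ⊎ Other a (n ∸ k))) →
    Oab k n a b x → (∀ c → p (inj₁ c) ≡ vQ (n ∸ k) b c) → (∀ j → split a x (inj₂ j) ≡ p (inj₂ j)) →
    ∀ j → x j ≡ p (mergeIndex a j)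
  Oab-merge b x p o row≡ off≡ = split-determines a x p agree
    where
    agree : ∀ j → split a x j ≡ p j
    agree (inj₁ c) = trans (Oab-row b x o c) (sym (row≡ c))
    agree (inj₂ j) = off≡ j

  Oab-cylinder : (b : Fin (suc (n ∸ k))) (x : Pt (Fin k × Fin (n ∸ k))) →
    Oab k n a b x ⇔
      ((∀ c → split a x (inj₁ c) ≡ vQ (n ∸ k) b c) × Qb k n a b (λ j → split a x (inj₂ j)))
  Oab-cylinder b x = mk⇔ (λ o → Oab-row b x o , (x , o , λ _ → refl)) from
    where
    from : ((∀ c → x (a , c) ≡ vQ (n ∸ k) b c) × Qb k n a b (λ j → split a x (inj₂ j))) → Oab k n a b x
    from (row≡ , (x' , o' , off≡)) =
      conv-resp (λ j → trans (sym (split-merge a x j)) (sym (Oab-merge b x' (split a x) o' row≡ off≡ j))) o'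

-- Part (2): v_0,…,v_m span a unimodular simplex

sumℤ-cong : {d : ℕ} (f g : Fin d → ℤ) → (∀ i → f i ≡ g i) → sumℤ f ≡ sumℤ g
sumℤ-cong {zero} f g f≡g = refl
sumℤ-cong {suc d} f g f≡g = cong₂ ℤ._+_ (f≡g fz) (sumℤ-cong (f ∘ fs) (g ∘ fs) (f≡g ∘ fs))

edgeCombination : (m : ℕ) → (Fin m → ℤ) → Fin m → ℤ
edgeCombination m c j = sumℤ (λ i → c i ℤ.* (vZ m (fs i) j ℤ.- vZ m fz j))

-- Every edge is -1 in the first coordinate ...
edgeCombination-head : (m : ℕ) (c : Fin (suc m) → ℤ) → edgeCombination (suc m) c fz ≡ ℤ.- sumℤ c
edgeCombination-head m c = negate-sum c
  where
  negate-sum : {d : ℕ} (c : Fin d → ℤ) → sumℤ (λ i → c i ℤ.* ℤ.-1ℤ) ≡ ℤ.- sumℤ c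
  negate-sum {zero} c = refl
  negate-sum {suc d} c = trans (cong (λ s → c fz ℤ.* ℤ.-1ℤ ℤ.+ s) (negate-sum (c ∘ fs))) (negate-step (c fz) (sumℤ (c ∘ fs)))
    where
    negate-step : ∀ x s → x ℤ.* ℤ.-1ℤ ℤ.+ ℤ.- s ≡ ℤ.- (x ℤ.+ s)
    negate-step = solve-∀

-- ... and the first edge vanishes in the other coordinates, where the
-- remaining edges are those of the simplex one dimension lower.
edgeCombination-tail : (m : ℕ) (c : Fin (suc m) → ℤ) (j : Fin m) →
  edgeCombination (suc m) c (fs j) ≡ edgeCombination m (c ∘ fs) j
edgeCombination-tail m c j =
  trans (cong (ℤ._+ edgeCombination m (c ∘ fs) j) (ℤP.*-zeroʳ (c fz))) (ℤP.+-identityˡ _)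

-- The inverse of the edge map: solve for the coefficients from the last
-- coordinate backwards (the first coordinate fixes c₀ once the others are known).
edgeCoefficients : (m : ℕ) → (Fin m → ℤ) → Fin m → ℤ
edgeCoefficients (suc m) z fz = ℤ.- z fz ℤ.- sumℤ (edgeCoefficients m (z ∘ fs))
edgeCoefficients (suc m) z (fs i) = edgeCoefficients m (z ∘ fs) i

edgeCoefficients-spans : (m : ℕ) (z : Fin m → ℤ) → ∀ j → z j ≡ edgeCombination m (edgeCoefficients m z) j
edgeCoefficients-spans (suc m) z fz =
  trans (recover (z fz) (sumℤ (edgeCoefficients m (z ∘ fs))))
        (sym (edgeCombination-head m (edgeCoefficients (suc m) z)))
  where
  recover : ∀ z₀ s → z₀ ≡ ℤ.- ((ℤ.- z₀ ℤ.- s) ℤ.+ s)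
  recover = solve-∀
edgeCoefficients-spans (suc m) z (fs j) =
  trans (edgeCoefficients-spans m (z ∘ fs) j)
        (sym (edgeCombination-tail m (edgeCoefficients (suc m) z) j))

edgeCoefficients-unique : (m : ℕ) (z c : Fin m → ℤ) →
  (∀ j → z j ≡ edgeCombination m c j) → ∀ i → c i ≡ edgeCoefficients m z i
edgeCoefficients-unique (suc m) z c z≡ fz = begin
  c fz                                                    ≡⟨ recover (c fz) (sumℤ (c ∘ fs)) ⟩
  ℤ.- (ℤ.- (c fz ℤ.+ sumℤ (c ∘ fs))) ℤ.- sumℤ (c ∘ fs)    ≡⟨ cong₂ (λ u s → ℤ.- u ℤ.- s) z₀≡ tail-sum ⟩
  ℤ.- z fz ℤ.- sumℤ (edgeCoefficients m (z ∘ fs))          ∎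
  where
  open ≡-Reasoning
  recover : ∀ c₀ s → c₀ ≡ ℤ.- (ℤ.- (c₀ ℤ.+ s)) ℤ.- s
  recover = solve-∀
  z₀≡ : ℤ.- (c fz ℤ.+ sumℤ (c ∘ fs)) ≡ z fz
  z₀≡ = sym (trans (z≡ fz) (edgeCombination-head m c))
  tail-sum : sumℤ (c ∘ fs) ≡ sumℤ (edgeCoefficients m (z ∘ fs))
  tail-sum = sumℤ-cong _ _ (edgeCoefficients-unique m (z ∘ fs) (c ∘ fs)
               (λ j → trans (z≡ (fs j)) (edgeCombination-tail m c j)))
edgeCoefficients-unique (suc m) z c z≡ (fs i) =
  edgeCoefficients-unique m (z ∘ fs) (c ∘ fs) (λ j → trans (z≡ (fs j)) (edgeCombination-tail m c j)) i

staircase-unimodular : (m : ℕ) → UnimodularSimplex m (vZ m)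
staircase-unimodular m =
  (λ z → edgeCoefficients m z , edgeCoefficients-spans m z) ,
  λ z c c' z≡c z≡c' i → trans (edgeCoefficients-unique m z c z≡c i) (sym (edgeCoefficients-unique m z c' z≡c' i))

-- Part (3): O_{k,n} = C(O^{a,0},…,O^{a,n-k})

CayleyVertex : (k n : ℕ) (a : Fin k) → Pt (Fin (n ∸ k) ⊎ Other a (n ∸ k)) → Set
CayleyVertex k n a p =
  Σ (Fin (suc (n ∸ k))) λ b → (∀ c → p (inj₁ c) ≡ vQ (n ∸ k) b c) × Qb k n a b (λ j → p (inj₂ j))

module _ (k n : ℕ) (a : Fin k) where

  vertex-in-slice : ∀ p → isχ k n p → CayleyVertex k n a (p ∘ splitIndex a)
  vertex-in-slice p (I , VI , p≡χ) with rowIndex I VI a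
  ... | b , Ia≡ = b , Oab-row k n a b p vertex , (p , vertex , λ _ → refl)
    where
    vertex : Oab k n a b p
    vertex = conv-singleton (I , VI , Ia≡ , p≡χ)

  slice-in-O : ∀ p → CayleyVertex k n a p → O k n (p ∘ mergeIndex a)
  slice-in-O p (b , row≡ , (x , o , off≡)) =
    conv-resp (λ j → sym (Oab-merge k n a b x p o row≡ off≡ j))
              (conv-mono (λ _ (I , VI , _ , p≡χ) → I , VI , p≡χ) x o)

  O-cayley : (x : Pt (Fin k × Fin (n ∸ k))) → O k n x ⇔ Cayley (vQ (n ∸ k)) (Qb k n a) (split a x)
  O-cayley x = mk⇔ to from
    where
    to : O k n x → Cayley (vQ (n ∸ k)) (Qb k n a) (split a x)
    to o = conv-resp (split-pullback a x) (conv-pullback (splitIndex a) vertex-in-slice x o)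
    from : Cayley (vQ (n ∸ k)) (Qb k n a) (split a x) → O k n x
    from h = conv-resp (λ j → sym (split-merge a x j))
               (conv-flatten _ (conv-pullback (mergeIndex a) slice-in-O (split a x) h))

lemma4p17 : (k n : ℕ) → 1 ≤ k → k < n → (a : Fin k) →
    ((b : Fin (suc (n ∸ k))) (x : Pt (Fin k × Fin (n ∸ k))) →
      Oab k n a b x ⇔
        ((∀ c → split a x (inj₁ c) ≡ vQ (n ∸ k) b c)
          × Qb k n a b (λ j → split a x (inj₂ j))))
    × UnimodularSimplex (n ∸ k) (vZ (n ∸ k))
    × ((x : Pt (Fin k × Fin (n ∸ k))) →
      O k n x ⇔ Cayley (vQ (n ∸ k)) (Qb k n a) (split a x))
lemma4p17 k n _ _ a = Oab-cylinder k n a , staircase-unimodular (n ∸ k) , O-cayley k n a
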